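{- Let $d>1$ be a squarefree integer with $d\equiv 1\pmod 4$, $K=\mathbb{Q}(\sqrt d)$, and let $d_1,d_2$ be positive integers with $d=d_1d_2$ and $d_1<d_2$. Write $d_1=p_1\cdots p_r$, $d_2=q_1\cdots q_s$ (prime factorizations), let $P_i,Q_j$ be the unique prime ideals of $O_K$ above $p_i,q_j$, and set $I_1=P_1\cdots P_r$, $I_2=Q_1\cdots Q_s$. Then $I_1$ and $I_2$ are PWR ideals if and only if $d_2<3d_1$ and the equation $k^2d_2-\ell^2d_1=\pm4$ has an integer solution $(k,\ell)$ (for some choice of sign). Moreover, in that case, for $i=1,2$ the elements $\frac{d_i+\sqrt d}{2},\ \frac{d_i-\sqrt d}{2}$ form a minimal basis of $I_i$.
   Context: $\Lambda:K\to\mathbb{R}^2$, $\Lambda(\alpha)=(\sigma_1(\alpha),\sigma_2(\alpha))$ where $\sigma_{1,2}(x+y\sqrt d)=x\pm y\sqrt d$. A lattice in $\mathbb{R}^2$ is well-rounded (WR) if its nonzero vectors of minimal Euclidean length span $\mathbb{R}^2$; a basis of a WR lattice consisting of two minimal vectors is a minimal basis. An ideal $I$ of $O_K$ is WR if $\Lambda(I)$ is WR, and PWR if it is principal and WR; $\alpha,\beta\in I$ form a minimal basis of $I$ if $\Lambda(\alpha),\Lambda(\beta)$ form a minimal basis of $\Lambda(I)$. -}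

module Defs where

open import Data.Nat as ℕ using (ℕ; _∸_; _/_)
open import Data.Nat.Divisibility using (_∣_)
open import Data.Integer as ℤ using (ℤ; +_; _+_; _*_; -_; _-_; _≤_)
open import Data.List using (List; []; _∷_)
open import Data.Product using (Σ; ∃; ∃-syntax; _×_)
open import Data.Sum using (_⊎_)
open import Data.Unit using (⊤)
open import Relation.Nullary using (¬_)
open import Relation.Binary.PropositionalEquality using (_≡_; _≢_)
open import Function.Bundles using (_⇔_)

SquareFree : ℕ → Set
SquareFree d = ∀ n → n ℕ.* n ∣ d → n ≡ 1

-- Elements of O_K (d ≡ 1 mod 4) written as x + y ω, ω = (1 + √d)/2.
record OK : Set where
  constructor ⟨_,_⟩
  field
    x : ℤ
    y : ℤ
open OK public

zeroK : OK
zeroK = ⟨ + 0 , + 0 ⟩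

oneK : OK
oneK = ⟨ + 1 , + 0 ⟩

fromℕK : ℕ → OK
fromℕK n = ⟨ + n , + 0 ⟩

fromℤK : ℤ → OK
fromℤK n = ⟨ n , + 0 ⟩

addK : OK → OK → OK
addK ⟨ a , b ⟩ ⟨ c , e ⟩ = ⟨ a + c , b + e ⟩

-- ω² = ω + (d-1)/4
mulK : ℕ → OK → OK → OK
mulK d ⟨ a , b ⟩ ⟨ c , e ⟩ =
  ⟨ a * c + (+ ((d ∸ 1) / 4)) * (b * e) , a * e + b * c + b * e ⟩

-- α = (A + B √d)/2 with A = 2x + y, B = y; so 2σ₁(α) = A + B√d, 2σ₂(α) = A - B√d.
coordA : OK → ℤ
coordA α = (+ 2) * x α + y α

coordB : OK → ℤ
coordB α = y α

-- normQ d α = A² + d B² = 2 · ‖Λ(α)‖²  (Euclidean length squared, up to factor 2)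
normQ : ℕ → OK → ℤ
normQ d α = coordA α * coordA α + (+ d) * (coordB α * coordB α)

-- Λ(α), Λ(β) linearly independent in ℝ²: det = (√d/2)(A_β B_α - A_α B_β) ≠ 0
Indep : OK → OK → Set
Indep α β = coordA α * coordB β - coordA β * coordB α ≢ + 0

record IsIdeal (d : ℕ) (I : OK → Set) : Set where
  field
    zero∈ : I zeroK
    add∈  : ∀ a b → I a → I b → I (addK a b)
    mul∈  : ∀ r a → I a → I (mulK d r a)

IsPrimeIdeal : ℕ → (OK → Set) → Set
IsPrimeIdeal d P =
  IsIdeal d P × ¬ P oneK × (∀ a b → P (mulK d a b) → P a ⊎ P b)

data ProdI (d : ℕ) (I J : OK → Set) : OK → Set where
  gen  : ∀ {a b} → I a → J b → ProdI d I J (mulK d a b)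
  zero : ProdI d I J zeroK
  add  : ∀ {a b} → ProdI d I J a → ProdI d I J b → ProdI d I J (addK a b)

ProdList : ℕ → List (OK → Set) → OK → Set
ProdList d [] = λ _ → ⊤
ProdList d (P ∷ Ps) = ProdI d P (ProdList d Ps)

Principal : ℕ → (OK → Set) → Set
Principal d I = Σ OK λ g → ∀ α → (I α ⇔ (∃[ r ] α ≡ mulK d r g))

Minimal : ℕ → (OK → Set) → OK → Set
Minimal d I α =
  I α × α ≢ zeroK × (∀ γ → I γ → γ ≢ zeroK → normQ d α ≤ normQ d γ)

WR : ℕ → (OK → Set) → Set
WR d I = ∃[ α ] ∃[ β ] (Minimal d I α × Minimal d I β × Indep α β)

PWR : ℕ → (OK → Set) → Set
PWR d I = Principal d I × WR d I

MinimalBasis : ℕ → (OK → Set) → OK → OK → Set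
MinimalBasis d I α β =
  Minimal d I α × Minimal d I β × Indep α β ×
  (∀ γ → I γ → ∃[ k ] ∃[ l ] γ ≡ addK (mulK d (fromℤK k) α) (mulK d (fromℤK l) β))

-- (dᵢ + √d)/2 and (dᵢ - √d)/2 form a minimal basis of I
HalfBasisClaim : ℕ → ℕ → (OK → Set) → Set
HalfBasisClaim d di I =
  ∀ α β → coordA α ≡ + di → coordB α ≡ + 1 →
          coordA β ≡ + di → coordB β ≡ - (+ 1) →
          MinimalBasis d I α β

-- Write d = 4c + 1 = m n. For m ∣ d the ideal T_m = {α ∈ O_K : m ∣ Tr α} is generated by m and
-- (m + √d)/2, and it is the product of the primes above the prime factors of m: a prime ideal
-- containing p ∣ d is T_p, and T_m T_n = T_mn for coprime m, n.
-- Writing Tr α = a m, an element α = (a m + y √d)/2 of T_m has a ≡ y (mod 2) and squared length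
-- m (m a² + n y²) (up to a factor 2), so T_m is well rounded, with minimal basis (m ± √d)/2, when
-- n/3 ≤ m ≤ 3n, while for 3m < n all its shortest vectors lie on ℤ; n = 3m cannot occur since d
-- is squarefree and d ≢ 3 (mod 4). T_m is principal iff it has an element of norm ±m, i.e. iff
-- m a² - n b² = ±4 is solvable: a generator g has N(g) = f m, and comparing with the norms of m
-- and √d gives f ∣ m and f ∣ n, whence f = ±1.

module Submission where

open import Defs
open import Agda.Builtin.FromNat using (Number; fromNat)
open import Agda.Builtin.FromNeg using (Negative; fromNeg)
open import Data.Unit using (tt)
import Data.Integer.Literals as ℤL
import Data.Nat.Literals as ℕL
open import Data.Nat as ℕ using (ℕ; zero; suc; _∸_; _/_; _%_; s≤s; z≤n)
open import Data.Nat.ListAction using (product)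
open import Data.List.Relation.Unary.All as All using (All)
import Data.Nat.Properties as ℕ
import Data.Nat.Divisibility as ℕ
open import Data.Nat.Coprimality as Coprime using (Coprime; coprime-Bézout)
open import Data.Nat.GCD using (module Bézout)
open import Data.Nat.Primality using (Prime; prime⇒irreducible)
open import Data.Integer as ℤ using (ℤ; +_; -_; -[1+_]; ∣_∣)
import Data.Integer.Properties as ℤ
open import Data.Integer.Tactic.RingSolver using (solve; solve-∀)
open import Data.List using (List; []; _∷_; map)
open import Data.Product using (∃-syntax; _×_; _,_; proj₁; proj₂)
open import Data.Sum as Sum using (_⊎_; inj₁; inj₂; [_,_]′; reduce)
open import Data.Empty using (⊥-elim)
open import Relation.Nullary using (¬_; Dec; yes; no)
open import Relation.Nullary.Decidable using (decidable-stable)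
open import Relation.Unary using (_⊆_; _≐_)
open import Relation.Unary.Properties using (≐-sym)
open import Relation.Binary.PropositionalEquality
open import Function.Base using (_∘_)
open import Function.Bundles using (_⇔_; mk⇔; Equivalence)

instance
  ℤ-number : Number ℤ
  ℤ-number = ℤL.number
  ℤ-negative : Negative ℤ
  ℤ-negative = ℤL.negative
  ℕ-number : Number ℕ
  ℕ-number = ℕL.number

module IntegerFacts where
  open import Data.Integer using (_+_; _*_; _-_)
  open import Data.Nat.DivMod using (m≡m%n+[m/n]*n; m*n/n≡m)
  open import Data.Integer.Divisibility.Signed
  open import Data.Integer.DivMod using (_/ℕ_; _%ℕ_; a≡a%ℕn+[a/ℕn]*n; n%ℕd<d)
  open ≡-Reasoning

  parity : ∀ z → ∃[ q ] (z ≡ 2 * q ⊎ z ≡ 2 * q + 1)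
  parity z with z %ℕ 2 | a≡a%ℕn+[a/ℕn]*n z 2 | n%ℕd<d z 2
  ... | 0           | z≡ | _ = z /ℕ 2 , inj₁ (trans z≡ (even (z /ℕ 2)))
    where even : ∀ q → 0 + q * 2 ≡ 2 * q
          even = solve-∀
  ... | 1           | z≡ | _ = z /ℕ 2 , inj₂ (trans z≡ (odd (z /ℕ 2)))
    where odd : ∀ q → 1 + q * 2 ≡ 2 * q + 1
          odd = solve-∀
  ... | suc (suc _) | _  | s≤s (s≤s ())

  2∤odd : ∀ q → ¬ (2 ∣ 2 * q + 1)
  2∤odd q 2∣odd with ℕ.∣1⇒≡1 (∣⇒∣ᵤ 2∣1)
    where
    odd-even : (2 * q + 1) - q * 2 ≡ 1
    odd-even = solve (q ∷ [])
    2∣1 : 2 ∣ 1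
    2∣1 = subst (2 ∣_) odd-even (∣m∣n⇒∣m-n 2∣odd (∣n⇒∣m*n q ∣-refl))
  ... | ()

  *-pres-∣ : ∀ {i j a b} → i ∣ a → j ∣ b → i * j ∣ a * b
  *-pres-∣ {i} {j} (divides q refl) (divides r refl) = divides (q * r) (solve (i ∷ j ∷ q ∷ r ∷ []))

  odd≢0 : ∀ j → 2 * j + 1 ≢ 0
  odd≢0 j 2j+1≡0 = 2∤odd j (subst (2 ∣_) (sym 2j+1≡0) (divides 0 refl))

  odd-form-parity : ∀ j k a b e → a * a * (2 * j + 1) - b * b * (2 * k + 1) ≡ 2 * e → ∃[ h ] a ≡ b + 2 * h
  odd-form-parity j k a b e form≡2e with parity (a - b)
  ... | q , inj₁ a-b≡2q = q , (begin
    a             ≡⟨ solve (a ∷ b ∷ []) ⟩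
    b + (a - b)   ≡⟨ cong (λ t → b + t) a-b≡2q ⟩
    b + 2 * q     ∎)
  ... | q , inj₂ a-b≡2q+1 = ⊥-elim (2∤odd (2 * q * q + 2 * q) (divides E square≡))
    where
    E = e - (j * (a * a) - k * (b * b)) - b * (a - b)
    square≡ : 2 * (2 * q * q + 2 * q) + 1 ≡ E * 2
    square≡ = begin
      2 * (2 * q * q + 2 * q) + 1
        ≡⟨ solve (q ∷ []) ⟩
      (2 * q + 1) * (2 * q + 1)
        ≡⟨ cong (λ t → t * t) (sym a-b≡2q+1) ⟩
      (a - b) * (a - b)
        ≡⟨ solve (j ∷ k ∷ a ∷ b ∷ []) ⟩
      a * a * (2 * j + 1) - b * b * (2 * k + 1) - 2 * (j * (a * a) - k * (b * b)) - 2 * (b * (a - b))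
        ≡⟨ cong (λ t → t - 2 * (j * (a * a) - k * (b * b)) - 2 * (b * (a - b))) form≡2e ⟩
      2 * e - 2 * (j * (a * a) - k * (b * b)) - 2 * (b * (a - b))
        ≡⟨ solve (j ∷ k ∷ a ∷ b ∷ e ∷ []) ⟩
      (e - (j * (a * a) - k * (b * b)) - b * (a - b)) * 2 ∎

  square≡∣∣² : ∀ i → i * i ≡ + (∣ i ∣ ℕ.* ∣ i ∣)
  square≡∣∣² (+ n)    = sym (ℤ.pos-* n n)
  square≡∣∣² -[1+ n ] = refl

  even≢0⇒2≤∣∣ : ∀ {z} h → z ≡ 2 * h → z ≢ 0 → 2 ℕ.≤ ∣ z ∣
  even≢0⇒2≤∣∣ h refl 2h≢0 = subst (2 ℕ.≤_) (sym (ℤ.abs-* 2 h)) (ℕ.*-monoʳ-≤ 2 (ℕ.n≢0⇒n>0 ∣h∣≢0))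
    where
    ∣h∣≢0 : ∣ h ∣ ≢ 0
    ∣h∣≢0 ∣h∣≡0 = 2h≢0 (cong (λ t → 2 * t) (ℤ.∣i∣≡0⇒i≡0 ∣h∣≡0))

  private
    pos-bézout : ∀ {a b c e} → 1 ℕ.+ a ℕ.* b ≡ c ℕ.* e → 1 + + a * + b ≡ + c * + e
    pos-bézout {a} {b} {c} {e} eq = begin
      1 + + a * + b        ≡⟨ cong (λ t → 1 + t) (sym (ℤ.pos-* a b)) ⟩
      + (1 ℕ.+ a ℕ.* b)    ≡⟨ cong +_ eq ⟩
      + (c ℕ.* e)          ≡⟨ ℤ.pos-* c e ⟩
      + c * + e            ∎

  coprime⇒bézout : ∀ {m n} → Coprime m n → ∃[ u ] ∃[ v ] u * + m + v * + n ≡ 1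
  coprime⇒bézout {m} {n} m⊥n with coprime-Bézout m⊥n
  ... | Bézout.+- u v eq = + u , - + v ,
    trans (cong (λ t → t + - + v * + n) (sym (pos-bézout {v} {n} {u} {m} eq))) (cancel (+ v) (+ n))
    where cancel : ∀ a b → 1 + a * b + - a * b ≡ 1
          cancel = solve-∀
  ... | Bézout.-+ u v eq = - + u , + v ,
    trans (cong (λ t → - + u * + m + t) (sym (pos-bézout {u} {m} {v} {n} eq))) (cancel (+ u) (+ m))
    where cancel : ∀ a b → - a * b + (1 + a * b) ≡ 1
          cancel = solve-∀

  prime∤⇒coprime : ∀ {p n} → Prime p → ¬ p ℕ.∣ n → Coprime p n
  prime∤⇒coprime p-prime p∤n (i∣p , i∣n) with prime⇒irreducible p-prime i∣p
  ... | inj₁ i≡1 = i≡1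
  ... | inj₂ refl = ⊥-elim (p∤n i∣n)

  prime-bézout : ∀ {p} z → Prime p → ¬ (+ p ∣ z) → ∃[ u ] ∃[ v ] u * z + v * + p ≡ 1
  prime-bézout {p} z p-prime p∤z with coprime⇒bézout (Coprime.sym (prime∤⇒coprime p-prime (p∤z ∘ ∣ᵤ⇒∣)))
  ... | u , v , eq with z
  ...   | + n    = u , v , eq
  ...   | -[1+ n ] = - u , v , trans (flip-sign u (+ suc n) v (+ p)) eq
    where flip-sign : ∀ u a v b → - u * - a + v * b ≡ u * a + v * b
          flip-sign = solve-∀

  squarefree⇒coprime : ∀ {d m n} → SquareFree d → m ℕ.* n ℕ.∣ d → Coprime m n
  squarefree⇒coprime sf mn∣d (i∣m , i∣n) = sf _ (ℕ.∣-trans (ℕ.*-pres-∣ i∣m i∣n) mn∣d)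

  squarefree-unit : ∀ {d m n f} → SquareFree d → m ℕ.* n ≡ d → f ∣ + m → f ∣ + n → f ≡ 1 ⊎ f ≡ -1
  squarefree-unit {d} {m} {n} {f} sf mn≡d f∣m f∣n = ±1 (sf ∣ f ∣ ff∣d)
    where
    ff∣d : ∣ f ∣ ℕ.* ∣ f ∣ ℕ.∣ d
    ff∣d = subst₂ ℕ._∣_ (ℤ.abs-* f f) (trans (ℤ.abs-* (+ m) (+ n)) mn≡d) (∣⇒∣ᵤ (*-pres-∣ f∣m f∣n))
    ±1 : ∀ {i} → ∣ i ∣ ≡ 1 → i ≡ 1 ⊎ i ≡ -1
    ±1 {+ _}      refl = inj₁ refl
    ±1 { -[1+ _ ]} refl = inj₂ refl

  %4≡1⇒≡4c+1 : ∀ {d} → d % 4 ≡ 1 → + d ≡ 4 * + ((d ∸ 1) / 4) + 1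
  %4≡1⇒≡4c+1 {d} d%4≡1 = begin
    + d                          ≡⟨ cong +_ d≡1+4q ⟩
    1 + + (q ℕ.* 4)              ≡⟨ cong (λ t → 1 + t) (ℤ.pos-* q 4) ⟩
    1 + + q * 4                  ≡⟨ rearrange (+ q) ⟩
    4 * + q + 1                  ≡⟨ cong (λ t → 4 * + t + 1) (sym c≡q) ⟩
    4 * + ((d ∸ 1) / 4) + 1      ∎
    where
    q = d / 4
    d≡1+4q : d ≡ 1 ℕ.+ q ℕ.* 4
    d≡1+4q = trans (m≡m%n+[m/n]*n d 4) (cong (ℕ._+ q ℕ.* 4) d%4≡1)
    c≡q : (d ∸ 1) / 4 ≡ q
    c≡q = trans (cong (λ t → (t ∸ 1) / 4) d≡1+4q) (m*n/n≡m q 4)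
    rearrange : ∀ q → 1 + q * 4 ≡ 4 * q + 1
    rearrange = solve-∀

  -- d = m · 3m would be divisible by m², so m = 1 and d = 3 ≢ 1 (mod 4)
  n≢3*m : ∀ {d m n} → SquareFree d → d % 4 ≡ 1 → m ℕ.* n ≡ d → n ≢ 3 ℕ.* m
  n≢3*m {d} {m} sf d%4≡1 mn≡d refl = 3%4≢1 (subst (λ t → t % 4 ≡ 1) d≡3 d%4≡1)
    where
    m·3m≡3·m² : m ℕ.* (3 ℕ.* m) ≡ 3 ℕ.* (m ℕ.* m)
    m·3m≡3·m² = trans (sym (ℕ.*-assoc m 3 m)) (trans (cong (ℕ._* m) (ℕ.*-comm m 3)) (ℕ.*-assoc 3 m m))
    m≡1 : m ≡ 1
    m≡1 = sf m (ℕ.divides 3 (trans (sym mn≡d) m·3m≡3·m²))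
    d≡3 : d ≡ 3
    d≡3 = trans (sym mn≡d) (cong (λ t → t ℕ.* (3 ℕ.* t)) m≡1)
    3%4≢1 : 3 % 4 ≢ 1
    3%4≢1 ()

  Pell : ℤ → ℤ → Set
  Pell m n = ∃[ k ] ∃[ ℓ ] ((k * k * m - ℓ * ℓ * n ≡ + 4) ⊎ (k * k * m - ℓ * ℓ * n ≡ - (+ 4)))

  Pell-swap : ∀ {m n} → Pell m n → Pell n m
  Pell-swap {m} {n} (k , ℓ , ±4) = ℓ , k , swap ±4
    where
    negate : ∀ k ℓ m n → ℓ * ℓ * n - k * k * m ≡ - (k * k * m - ℓ * ℓ * n)
    negate = solve-∀
    swap : (k * k * m - ℓ * ℓ * n ≡ 4) ⊎ (k * k * m - ℓ * ℓ * n ≡ -4) →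
           (ℓ * ℓ * n - k * k * m ≡ 4) ⊎ (ℓ * ℓ * n - k * k * m ≡ -4)
    swap (inj₁ ≡4)  = inj₂ (trans (negate k ℓ m n) (cong -_ ≡4))
    swap (inj₂ ≡-4) = inj₁ (trans (negate k ℓ m n) (cong -_ ≡-4))

-- the norm form of T_m in the coordinates ∣ tr α / m ∣ and ∣ y α ∣ (up to the factor m)
form : ℕ → ℕ → ℕ → ℕ → ℕ
form m n A B = m ℕ.* (A ℕ.* A) ℕ.+ n ℕ.* (B ℕ.* B)

module _ {m n : ℕ} where
  open ℕ.≤-Reasoning

  form-1-1 : form m n 1 1 ≡ m ℕ.+ n
  form-1-1 = cong₂ ℕ._+_ (ℕ.*-identityʳ m) (ℕ.*-identityʳ n)

  form-2-0 : form m n 2 0 ≡ 4 ℕ.* m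
  form-2-0 = trans (cong₂ ℕ._+_ (ℕ.*-comm m 4) (ℕ.*-zeroʳ n)) (ℕ.+-identityʳ (4 ℕ.* m))

  form-1-1≤ : ∀ {A B} → form m n 1 1 ℕ.≤ form m n (suc A) (suc B)
  form-1-1≤ = ℕ.+-mono-≤ (ℕ.*-monoʳ-≤ m (s≤s z≤n)) (ℕ.*-monoʳ-≤ n (s≤s z≤n))

  form-lower : n ℕ.≤ 3 ℕ.* m → m ℕ.≤ 3 ℕ.* n → ∀ {A B} → (B ≡ 0 → 2 ℕ.≤ A) → (A ≡ 0 → 2 ℕ.≤ B) →
               form m n 1 1 ℕ.≤ form m n A B
  form-lower _ m≤3n {zero} {B} _ 2≤B = begin
    form m n 1 1                 ≡⟨ form-1-1 ⟩
    m ℕ.+ n                      ≤⟨ ℕ.+-monoˡ-≤ n m≤3n ⟩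
    3 ℕ.* n ℕ.+ n                ≡⟨ trans (ℕ.+-comm (3 ℕ.* n) n) (ℕ.*-comm 4 n) ⟩
    n ℕ.* (2 ℕ.* 2)              ≤⟨ ℕ.*-monoʳ-≤ n (ℕ.*-mono-≤ (2≤B refl) (2≤B refl)) ⟩
    n ℕ.* (B ℕ.* B)              ≡⟨ cong (ℕ._+ n ℕ.* (B ℕ.* B)) (sym (ℕ.*-zeroʳ m)) ⟩
    form m n 0 B                 ∎
  form-lower n≤3m _ {suc A} {zero} 2≤A _ = begin
    form m n 1 1                 ≡⟨ form-1-1 ⟩
    m ℕ.+ n                      ≤⟨ ℕ.+-monoʳ-≤ m n≤3m ⟩
    4 ℕ.* m                      ≡⟨ ℕ.*-comm 4 m ⟩
    m ℕ.* (2 ℕ.* 2)              ≤⟨ ℕ.*-monoʳ-≤ m (ℕ.*-mono-≤ (2≤A refl) (2≤A refl)) ⟩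
    m ℕ.* (suc A ℕ.* suc A)      ≤⟨ ℕ.m≤m+n _ _ ⟩
    form m n (suc A) 0           ∎
  form-lower _ _ {suc A} {suc B} _ _ = form-1-1≤ {A} {B}

  form-strict : 3 ℕ.* m ℕ.< n → ∀ {A B} → 1 ℕ.≤ B → (A ≡ 0 → 2 ℕ.≤ B) → form m n 2 0 ℕ.< form m n A B
  form-strict 3m<n {zero} {B} _ 2≤B = begin-strict
    form m n 2 0                 ≡⟨ form-2-0 ⟩
    4 ℕ.* m                      <⟨ ℕ.*-monoʳ-< 4 (ℕ.≤-<-trans (ℕ.m≤m+n m (2 ℕ.* m)) 3m<n) ⟩
    4 ℕ.* n                      ≡⟨ ℕ.*-comm 4 n ⟩
    n ℕ.* (2 ℕ.* 2)              ≤⟨ ℕ.*-monoʳ-≤ n (ℕ.*-mono-≤ (2≤B refl) (2≤B refl)) ⟩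
    n ℕ.* (B ℕ.* B)              ≡⟨ cong (ℕ._+ n ℕ.* (B ℕ.* B)) (sym (ℕ.*-zeroʳ m)) ⟩
    form m n 0 B                 ∎
  form-strict 3m<n {suc A} {suc B} _ _ = begin-strict
    form m n 2 0                 ≡⟨ form-2-0 ⟩
    m ℕ.+ 3 ℕ.* m                <⟨ ℕ.+-monoʳ-< m 3m<n ⟩
    m ℕ.+ n                      ≡⟨ sym form-1-1 ⟩
    form m n 1 1                 ≤⟨ form-1-1≤ {A} {B} ⟩
    form m n (suc A) (suc B)     ∎

module _ {d : ℕ} {I J : OK → Set} (I≐J : I ≐ J) where
  private
    I⊆J = proj₁ I≐J
    J⊆I = proj₂ I≐J

  Principal-resp-≐ : Principal d I → Principal d J
  Principal-resp-≐ (g , I≡⟨g⟩) =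
    g , λ α → mk⇔ (Equivalence.to (I≡⟨g⟩ α) ∘ J⊆I) (I⊆J ∘ Equivalence.from (I≡⟨g⟩ α))

  Minimal-resp-≐ : ∀ {α} → Minimal d I α → Minimal d J α
  Minimal-resp-≐ (α∈I , α≢0 , α-shortest) = I⊆J α∈I , α≢0 , λ γ γ∈J → α-shortest γ (J⊆I γ∈J)

  WR-resp-≐ : WR d I → WR d J
  WR-resp-≐ (α , β , α-min , β-min , indep) = α , β , Minimal-resp-≐ α-min , Minimal-resp-≐ β-min , indep

  PWR-resp-≐ : PWR d I → PWR d J
  PWR-resp-≐ (principal , wr) = Principal-resp-≐ principal , WR-resp-≐ wr

  HalfBasisClaim-resp-≐ : ∀ {m} → HalfBasisClaim d m I → HalfBasisClaim d m J
  HalfBasisClaim-resp-≐ claim α β A₁ B₁ A₂ B₂ with claim α β A₁ B₁ A₂ B₂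
  ... | α-min , β-min , indep , spans =
    Minimal-resp-≐ α-min , Minimal-resp-≐ β-min , indep , λ γ γ∈J → spans γ (J⊆I γ∈J)

module QuadraticOrder (c : ℤ) where
  open import Data.Integer using (_+_; _*_; _-_)
  open import Data.Integer.Divisibility.Signed
  open IntegerFacts
  open ≡-Reasoning

  Δ : ℤ
  Δ = 4 * c + 1

  infixl 7 _·_
  infixl 6 _⊕_

  _·_ : OK → OK → OK
  ⟨ a , b ⟩ · ⟨ a′ , b′ ⟩ = ⟨ a * a′ + c * (b * b′) , a * b′ + b * a′ + b * b′ ⟩

  _⊕_ : OK → OK → OK
  _⊕_ = addK

  -- coordA α = α + ᾱ
  tr : OK → ℤ
  tr = coordA

  conj : OK → OK
  conj ⟨ a , b ⟩ = ⟨ a + b , - b ⟩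

  norm : OK → ℤ
  norm ⟨ a , b ⟩ = a * a + a * b - c * (b * b)

  OK-≡ : ∀ {α β} → x α ≡ x β → y α ≡ y β → α ≡ β
  OK-≡ = cong₂ ⟨_,_⟩

  ·-comm : ∀ α β → α · β ≡ β · α
  ·-comm ⟨ a , b ⟩ ⟨ a′ , b′ ⟩ = OK-≡ x-eq y-eq
    where
    x-eq : a * a′ + c * (b * b′) ≡ a′ * a + c * (b′ * b)
    x-eq = solve (c ∷ a ∷ b ∷ a′ ∷ b′ ∷ [])
    y-eq : a * b′ + b * a′ + b * b′ ≡ a′ * b + b′ * a + b′ * b
    y-eq = solve (a ∷ b ∷ a′ ∷ b′ ∷ [])

  ·-assoc : ∀ α β γ → α · β · γ ≡ α · (β · γ)
  ·-assoc ⟨ a , b ⟩ ⟨ a′ , b′ ⟩ ⟨ a″ , b″ ⟩ = OK-≡ x-eq y-eq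
    where
    x-eq : (a * a′ + c * (b * b′)) * a″ + c * ((a * b′ + b * a′ + b * b′) * b″)
         ≡ a * (a′ * a″ + c * (b′ * b″)) + c * (b * (a′ * b″ + b′ * a″ + b′ * b″))
    x-eq = solve (c ∷ a ∷ b ∷ a′ ∷ b′ ∷ a″ ∷ b″ ∷ [])
    y-eq : (a * a′ + c * (b * b′)) * b″ + (a * b′ + b * a′ + b * b′) * a″
             + (a * b′ + b * a′ + b * b′) * b″
         ≡ a * (a′ * b″ + b′ * a″ + b′ * b″) + b * (a′ * a″ + c * (b′ * b″))
             + b * (a′ * b″ + b′ * a″ + b′ * b″)
    y-eq = solve (c ∷ a ∷ b ∷ a′ ∷ b′ ∷ a″ ∷ b″ ∷ [])

  ·-distribˡ-⊕ : ∀ α β γ → α · (β ⊕ γ) ≡ α · β ⊕ α · γ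
  ·-distribˡ-⊕ ⟨ a , b ⟩ ⟨ a′ , b′ ⟩ ⟨ a″ , b″ ⟩ = OK-≡ x-eq y-eq
    where
    x-eq : a * (a′ + a″) + c * (b * (b′ + b″)) ≡ a * a′ + c * (b * b′) + (a * a″ + c * (b * b″))
    x-eq = solve (c ∷ a ∷ b ∷ a′ ∷ b′ ∷ a″ ∷ b″ ∷ [])
    y-eq : a * (b′ + b″) + b * (a′ + a″) + b * (b′ + b″)
         ≡ a * b′ + b * a′ + b * b′ + (a * b″ + b * a″ + b * b″)
    y-eq = solve (a ∷ b ∷ a′ ∷ b′ ∷ a″ ∷ b″ ∷ [])

  ·-zeroʳ : ∀ α → α · zeroK ≡ zeroK
  ·-zeroʳ ⟨ a , b ⟩ = OK-≡ x-eq y-eq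
    where
    x-eq : a * 0 + c * (b * 0) ≡ 0
    x-eq = solve (c ∷ a ∷ b ∷ [])
    y-eq : a * 0 + b * 0 + b * 0 ≡ 0
    y-eq = solve (a ∷ b ∷ [])

  fromℤK-· : ∀ k α → fromℤK k · α ≡ ⟨ k * x α , k * y α ⟩
  fromℤK-· k ⟨ a , b ⟩ = OK-≡ x-eq y-eq
    where
    x-eq : k * a + c * (0 * b) ≡ k * a
    x-eq = solve (c ∷ k ∷ a ∷ b ∷ [])
    y-eq : k * b + 0 * a + 0 * b ≡ k * b
    y-eq = solve (k ∷ a ∷ b ∷ [])

  ·-conj : ∀ α → α · conj α ≡ fromℤK (norm α)
  ·-conj ⟨ a , b ⟩ = OK-≡ x-eq y-eq
    where
    x-eq : a * (a + b) + c * (b * - b) ≡ a * a + a * b - c * (b * b)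
    x-eq = solve (c ∷ a ∷ b ∷ [])
    y-eq : a * - b + b * (a + b) + b * - b ≡ 0
    y-eq = solve (a ∷ b ∷ [])

  norm-· : ∀ α β → norm (α · β) ≡ norm α * norm β
  norm-· ⟨ a , b ⟩ ⟨ a′ , b′ ⟩ = multiplicative
    where
    multiplicative : let A = a * a′ + c * (b * b′); B = a * b′ + b * a′ + b * b′ in
      A * A + A * B - c * (B * B) ≡ (a * a + a * b - c * (b * b)) * (a′ * a′ + a′ * b′ - c * (b′ * b′))
    multiplicative = solve (c ∷ a ∷ b ∷ a′ ∷ b′ ∷ [])

  4norm≡tr²-Δy² : ∀ α → 4 * norm α ≡ tr α * tr α - Δ * (y α * y α)
  4norm≡tr²-Δy² ⟨ a , b ⟩ = eq
    where
    eq : 4 * (a * a + a * b - c * (b * b)) ≡ (2 * a + b) * (2 * a + b) - (4 * c + 1) * (b * b)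
    eq = solve (c ∷ a ∷ b ∷ [])

  2tr-· : ∀ α β → 2 * tr (α · β) ≡ tr α * tr β + Δ * (y α * y β)
  2tr-· ⟨ a , b ⟩ ⟨ a′ , b′ ⟩ = eq
    where
    eq : 2 * (2 * (a * a′ + c * (b * b′)) + (a * b′ + b * a′ + b * b′))
       ≡ (2 * a + b) * (2 * a′ + b′) + (4 * c + 1) * (b * b′)
    eq = solve (c ∷ a ∷ b ∷ a′ ∷ b′ ∷ [])

  2y-· : ∀ α β → 2 * y (α · β) ≡ tr α * y β + y α * tr β
  2y-· ⟨ a , b ⟩ ⟨ a′ , b′ ⟩ = eq
    where
    eq : 2 * (a * b′ + b * a′ + b * b′) ≡ (2 * a + b) * b′ + b * (2 * a′ + b′)
    eq = solve (a ∷ b ∷ a′ ∷ b′ ∷ [])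

  2x≡tr-y : ∀ α → 2 * x α ≡ tr α - y α
  2x≡tr-y ⟨ a , b ⟩ = eq
    where
    eq : 2 * a ≡ 2 * a + b - b
    eq = solve (a ∷ b ∷ [])

  tr-⊕ : ∀ α β → tr (α ⊕ β) ≡ tr α + tr β
  tr-⊕ ⟨ a , b ⟩ ⟨ a′ , b′ ⟩ = eq
    where
    eq : 2 * (a + a′) + (b + b′) ≡ 2 * a + b + (2 * a′ + b′)
    eq = solve (a ∷ b ∷ a′ ∷ b′ ∷ [])

  tr-conj : ∀ α → tr (conj α) ≡ tr α
  tr-conj ⟨ a , b ⟩ = eq
    where
    eq : 2 * (a + b) + - b ≡ 2 * a + b
    eq = solve (a ∷ b ∷ [])

  cayley-hamilton : ∀ α → α · α ≡ α · fromℤK (tr α) ⊕ fromℤK (- norm α)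
  cayley-hamilton ⟨ a , b ⟩ = OK-≡ x-eq y-eq
    where
    x-eq : a * a + c * (b * b)
         ≡ a * (2 * a + b) + c * (b * 0) + - (a * a + a * b - c * (b * b))
    x-eq = solve (c ∷ a ∷ b ∷ [])
    y-eq : a * b + b * a + b * b ≡ a * 0 + b * (2 * a + b) + b * 0 + 0
    y-eq = solve (a ∷ b ∷ [])

  tr-injective : ∀ {α β} → tr α ≡ tr β → y α ≡ y β → α ≡ β
  tr-injective {⟨ a , b ⟩} {⟨ a′ , .b ⟩} tr≡ refl = OK-≡ (ℤ.*-cancelˡ-≡ 2 a a′ 2a≡2a′) refl
    where
    2a≡2a′ : 2 * a ≡ 2 * a′
    2a≡2a′ = begin
      2 * a          ≡⟨ solve (a ∷ b ∷ []) ⟩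
      2 * a + b - b  ≡⟨ cong (_- b) tr≡ ⟩
      2 * a′ + b - b ≡⟨ solve (a′ ∷ b ∷ []) ⟩
      2 * a′         ∎

  fromℤK-cancel : ∀ {k α β} → k ≢ 0 → fromℤK k · α ≡ fromℤK k · β → α ≡ β
  fromℤK-cancel {k} {α} {β} k≢0 kα≡kβ =
    OK-≡ (ℤ.*-cancelˡ-≡ k (x α) (x β) (cong x kα≡kβ′)) (ℤ.*-cancelˡ-≡ k (y α) (y β) (cong y kα≡kβ′))
    where
    instance _ = ℤ.≢-nonZero k≢0
    kα≡kβ′ : ⟨ k * x α , k * y α ⟩ ≡ ⟨ k * x β , k * y β ⟩
    kα≡kβ′ = trans (sym (fromℤK-· k α)) (trans kα≡kβ (fromℤK-· k β))

  decompose : ∀ w α → α ≡ fromℤK (y α) · ⟨ w , 1 ⟩ ⊕ fromℤK (x α - w * y α)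
  decompose w ⟨ a , b ⟩ = OK-≡ x-eq y-eq
    where
    x-eq : a ≡ b * w + c * (0 * 1) + (a - w * b)
    x-eq = solve (c ∷ w ∷ a ∷ b ∷ [])
    y-eq : b ≡ b * 1 + 0 * w + 0 * 1 + 0
    y-eq = solve (w ∷ b ∷ [])

  integer-part : ∀ w α → fromℤK (x α - w * y α) ≡ α ⊕ fromℤK (- y α) · ⟨ w , 1 ⟩
  integer-part w ⟨ a , b ⟩ = OK-≡ x-eq y-eq
    where
    x-eq : a - w * b ≡ a + (- b * w + c * (0 * 1))
    x-eq = solve (c ∷ w ∷ a ∷ b ∷ [])
    y-eq : 0 ≡ b + (- b * 1 + 0 * w + 0 * 1)
    y-eq = solve (w ∷ b ∷ [])

  2*integer-part : ∀ w α → 2 * (x α - w * y α) ≡ tr α - y α * tr ⟨ w , 1 ⟩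
  2*integer-part w ⟨ a , b ⟩ = eq
    where
    eq : 2 * (a - w * b) ≡ 2 * a + b - b * (2 * w + 1)
    eq = solve (w ∷ a ∷ b ∷ [])

  tr-fromℤK-· : ∀ k α → tr (fromℤK k · α) ≡ k * tr α
  tr-fromℤK-· k ⟨ a , b ⟩ = eq
    where
    eq : 2 * (k * a + c * (0 * b)) + (k * b + 0 * a + 0 * b) ≡ k * (2 * a + b)
    eq = solve (c ∷ k ∷ a ∷ b ∷ [])

  ·-identityˡ : ∀ α → oneK · α ≡ α
  ·-identityˡ α = trans (fromℤK-· 1 α) (OK-≡ (ℤ.*-identityˡ (x α)) (ℤ.*-identityˡ (y α)))

  norm-fromℤK : ∀ k → norm (fromℤK k) ≡ k * k
  norm-fromℤK k = eq
    where
    eq : k * k + k * 0 - c * (0 * 0) ≡ k * k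
    eq = solve (c ∷ k ∷ [])

  √d : OK
  √d = ⟨ -1 , 2 ⟩

  norm-√d : norm √d ≡ - Δ
  norm-√d = eq
    where
    eq : -1 * -1 + -1 * 2 - c * (2 * 2) ≡ - (4 * c + 1)
    eq = solve (c ∷ [])

  infix 4 _∣ᴼ_
  _∣ᴼ_ : OK → OK → Set
  g ∣ᴼ α = ∃[ r ] α ≡ r · g

  ∣ᴼ⇒norm∣ : ∀ {g α} → g ∣ᴼ α → norm g ∣ norm α
  ∣ᴼ⇒norm∣ {g} (r , refl) = divides (norm r) (norm-· r g)

  -- α / g = α ḡ / N(g)
  ∣ᴼ-by-conj : ∀ {g α ρ} → norm g ≢ 0 → α · conj g ≡ fromℤK (norm g) · ρ → α ≡ ρ · g
  ∣ᴼ-by-conj {g} {α} {ρ} Ng≢0 αḡ≡Nρ = fromℤK-cancel Ng≢0 (begin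
    fromℤK (norm g) · α     ≡⟨ cong (_· α) (sym (·-conj g)) ⟩
    g · conj g · α          ≡⟨ ·-comm (g · conj g) α ⟩
    α · (g · conj g)        ≡⟨ cong (α ·_) (·-comm g (conj g)) ⟩
    α · (conj g · g)        ≡⟨ sym (·-assoc α (conj g) g) ⟩
    α · conj g · g          ≡⟨ cong (_· g) αḡ≡Nρ ⟩
    fromℤK (norm g) · ρ · g ≡⟨ ·-assoc (fromℤK (norm g)) ρ g ⟩
    fromℤK (norm g) · (ρ · g) ∎)

  -- for m ∣ Δ, the ideal (m, (m + √d)/2)
  TraceIdeal : ℤ → OK → Set
  TraceIdeal m α = m ∣ tr α

  ∣Δ⇒odd : ∀ {m} → m ∣ Δ → ∃[ j ] m ≡ 2 * j + 1
  ∣Δ⇒odd {m} m∣Δ with parity m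
  ... | j , inj₂ m≡2j+1 = j , m≡2j+1
  ... | q , inj₁ refl   = ⊥-elim (2∤odd (2 * c) (subst (2 ∣_) Δ-odd (∣-trans (∣m⇒∣m*n q ∣-refl) m∣Δ)))
    where
    Δ-odd : 4 * c + 1 ≡ 2 * (2 * c) + 1
    Δ-odd = solve (c ∷ [])

  ∣Δ∧∣2*⇒∣ : ∀ {m z} → m ∣ Δ → m ∣ 2 * z → m ∣ z
  ∣Δ∧∣2*⇒∣ {m} {z} m∣Δ m∣2z = subst (m ∣_) eq (∣m∣n⇒∣m-n (∣m⇒∣m*n z m∣Δ) (∣m⇒∣m*n (2 * c) m∣2z))
    where
    eq : (4 * c + 1) * z - 2 * z * (2 * c) ≡ z
    eq = solve (c ∷ z ∷ [])

  m∈TraceIdeal : ∀ m → TraceIdeal m (fromℤK m)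
  m∈TraceIdeal m = divides 2 tr≡2m
    where
    tr≡2m : 2 * m + 0 ≡ 2 * m
    tr≡2m = solve (m ∷ [])

  module _ {m : ℤ} where

    TraceIdeal-⊕ : ∀ {α β} → TraceIdeal m α → TraceIdeal m β → TraceIdeal m (α ⊕ β)
    TraceIdeal-⊕ {α} {β} m∣α m∣β = subst (m ∣_) (sym (tr-⊕ α β)) (∣m∣n⇒∣m+n m∣α m∣β)

    TraceIdeal-· : m ∣ Δ → ∀ r {α} → TraceIdeal m α → TraceIdeal m (r · α)
    TraceIdeal-· m∣Δ r {α} m∣α = ∣Δ∧∣2*⇒∣ m∣Δ
      (subst (m ∣_) (sym (2tr-· r α)) (∣m∣n⇒∣m+n (∣n⇒∣m*n (tr r) m∣α) (∣m⇒∣m*n (y r * y α) m∣Δ)))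

    TraceIdeal-conj : ∀ {α} → TraceIdeal m α → TraceIdeal m (conj α)
    TraceIdeal-conj {α} = subst (m ∣_) (sym (tr-conj α))

    TraceIdeal-·-conj : m ∣ Δ → ∀ {α β} → TraceIdeal m α → TraceIdeal m β →
                        ∃[ ρ ] α · conj β ≡ fromℤK m · ρ
    TraceIdeal-·-conj m∣Δ {α} {β} m∣α m∣β =
      ⟨ quotient m∣x , quotient m∣y ⟩ , trans γ≡ (sym (fromℤK-· m _))
      where
      γ = α · conj β
      m∣tr : m ∣ tr γ
      m∣tr = TraceIdeal-· m∣Δ α (TraceIdeal-conj {β} m∣β)
      m∣y : m ∣ y γ
      m∣y = ∣Δ∧∣2*⇒∣ m∣Δ (subst (m ∣_) (sym (2y-· α (conj β)))
              (∣m∣n⇒∣m+n (∣m⇒∣m*n (y (conj β)) m∣α) (∣n⇒∣m*n (y α) (TraceIdeal-conj {β} m∣β))))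
      m∣x : m ∣ x γ
      m∣x = ∣Δ∧∣2*⇒∣ m∣Δ (subst (m ∣_) (sym (2x≡tr-y γ)) (∣m∣n⇒∣m-n m∣tr m∣y))
      γ≡ : γ ≡ ⟨ m * quotient m∣x , m * quotient m∣y ⟩
      γ≡ = OK-≡ (trans (_∣_.equality m∣x) (ℤ.*-comm _ m)) (trans (_∣_.equality m∣y) (ℤ.*-comm _ m))

module TraceIdeals (d : ℕ) (d≡Δ : + d ≡ 4 ℤ.* + ((d ∸ 1) / 4) ℤ.+ 1) where
  open import Data.Integer using (_+_; _*_; _-_)
  open import Data.Integer.Divisibility.Signed
  open IntegerFacts
  open QuadraticOrder (+ ((d ∸ 1) / 4)) public
  open ≡-Reasoning

  ∣d⇒∣Δ : ∀ {m} → m ℕ.∣ d → + m ∣ Δ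
  ∣d⇒∣Δ m∣d = subst (_ ∣_) d≡Δ (∣ᵤ⇒∣ m∣d)

  ProdI-isIdeal : ∀ {I J} → IsIdeal d I → IsIdeal d (ProdI d I J)
  ProdI-isIdeal {I} {J} I-ideal = record { zero∈ = zero ; add∈ = λ _ _ → add ; mul∈ = mul∈ }
    where
    mul∈ : ∀ r a → ProdI d I J a → ProdI d I J (r · a)
    mul∈ r _ (gen {a} {b} a∈I b∈J) =
      subst (ProdI d I J) (·-assoc r a b) (gen (IsIdeal.mul∈ I-ideal r a a∈I) b∈J)
    mul∈ r _ zero = subst (ProdI d I J) (sym (·-zeroʳ r)) zero
    mul∈ r _ (add {a} {b} a∈IJ b∈IJ) =
      subst (ProdI d I J) (sym (·-distribˡ-⊕ r a b)) (add (mul∈ r a a∈IJ) (mul∈ r b b∈IJ))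

  -- α = y(α) ⟨w,1⟩ + z with z ∈ ℤ ∩ T_m = m ℤ
  ideal≐TraceIdeal : ∀ {J m w} → IsIdeal d J → m ∣ Δ → J ⊆ TraceIdeal m →
                     J (fromℤK m) → J ⟨ w , 1 ⟩ → J ≐ TraceIdeal m
  ideal≐TraceIdeal {J} {m} {w} J-ideal m∣Δ J⊆T m∈J ω∈J = J⊆T , T⊆J
    where
    open IsIdeal J-ideal
    T⊆J : TraceIdeal m ⊆ J
    T⊆J {α} m∣α = subst J (sym (decompose w α))
      (add∈ _ _ (mul∈ (fromℤK (y α)) _ ω∈J) (subst J z≡k·m (mul∈ (fromℤK k) _ m∈J)))
      where
      z = x α - w * y α
      m∣z : m ∣ z
      m∣z = ∣Δ∧∣2*⇒∣ m∣Δ (subst (m ∣_) (sym (2*integer-part w α))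
              (∣m∣n⇒∣m-n m∣α (∣n⇒∣m*n (y α) (J⊆T ω∈J))))
      k = quotient m∣z
      z≡k·m : fromℤK k · fromℤK m ≡ fromℤK z
      z≡k·m = trans (fromℤK-· k (fromℤK m))
                    (OK-≡ (sym (_∣_.equality m∣z)) (ℤ.*-zeroʳ k))

  primeIdeal≐TraceIdeal : ∀ {p P} → Prime p → p ℕ.∣ d → IsPrimeIdeal d P → P (fromℕK p) →
                          P ≐ TraceIdeal (+ p)
  primeIdeal≐TraceIdeal {p} {P} p-prime p∣d (P-ideal , 1∉P , P-prime) p∈P =
    ideal≐TraceIdeal P-ideal p∣Δ P⊆T p∈P ω∈P
    where
    open IsIdeal P-ideal
    p∣Δ = ∣d⇒∣Δ p∣d
    j = proj₁ (∣Δ⇒odd p∣Δ)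
    ω = ⟨ j , 1 ⟩
    p∣trω : + p ∣ tr ω
    p∣trω = ∣-reflexive (proj₂ (∣Δ⇒odd p∣Δ))

    -- 4 N(ω) = p² - Δ
    p∣Nω : + p ∣ norm ω
    p∣Nω = ∣Δ∧∣2*⇒∣ p∣Δ (∣Δ∧∣2*⇒∣ p∣Δ
      (subst (+ p ∣_) (trans (sym (4norm≡tr²-Δy² ω)) (ℤ.*-assoc 2 2 (norm ω)))
             (∣m∣n⇒∣m-n (∣n⇒∣m*n (tr ω) p∣trω) (∣m⇒∣m*n (y ω * y ω) p∣Δ))))

    -- ω² = tr(ω) ω - N(ω) lies in P, and P is prime
    ω∈P : P ω
    ω∈P = reduce (P-prime ω ω (subst P (sym (cayley-hamilton ω)) (add∈ _ _ ω·trω∈P -Nω∈P)))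
      where
      ω·trω∈P : P (ω · fromℤK (tr ω))
      ω·trω∈P = subst (λ t → P (ω · fromℤK t)) (proj₂ (∣Δ⇒odd p∣Δ)) (mul∈ ω _ p∈P)
      k = quotient p∣Nω
      -Nω∈P : P (fromℤK (- norm ω))
      -Nω∈P = subst P (trans (fromℤK-· (- k) (fromℤK (+ p)))
                        (OK-≡ (trans (sym (ℤ.neg-distribˡ-* k (+ p))) (cong -_ (sym (_∣_.equality p∣Nω))))
                              (ℤ.*-zeroʳ (- k))))
                (mul∈ (fromℤK (- k)) _ p∈P)

    P⊆T : P ⊆ TraceIdeal (+ p)
    P⊆T {α} α∈P = p∣trα (+ p ∣? z)
      where
      z = x α - j * y α
      z∈P : P (fromℤK z)
      z∈P = subst P (sym (integer-part j α)) (add∈ _ _ α∈P (mul∈ (fromℤK (- y α)) ω ω∈P))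
      1∈P : ∃[ u ] ∃[ v ] u * z + v * + p ≡ 1 → P oneK
      1∈P (u , v , bézout) = subst P uz+vp≡1
        (add∈ _ _ (mul∈ (fromℤK u) _ z∈P) (mul∈ (fromℤK v) _ p∈P))
        where
        y-eq : u * 0 + v * 0 ≡ 0
        y-eq = solve (u ∷ v ∷ [])
        uz+vp≡1 : fromℤK u · fromℤK z ⊕ fromℤK v · fromℤK (+ p) ≡ oneK
        uz+vp≡1 = trans (cong₂ _⊕_ (fromℤK-· u (fromℤK z)) (fromℤK-· v (fromℤK (+ p))))
                        (OK-≡ bézout y-eq)
      p∣trα : Dec (+ p ∣ z) → + p ∣ tr α
      p∣trα (yes p∣z) = ∣m+n∣n⇒∣m (subst (+ p ∣_) (2*integer-part j α) (∣n⇒∣m*n 2 p∣z))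
                                  (∣m⇒∣-m (∣n⇒∣m*n (y α) p∣trω))
      p∣trα (no p∤z)  = ⊥-elim (1∉P (1∈P (prime-bézout z p-prime p∤z)))

  ProdI≐TraceIdeal : ∀ {I J m n} → IsIdeal d I →
                     I ≐ TraceIdeal (+ m) → J ≐ TraceIdeal (+ n) → Coprime m n → m ℕ.* n ℕ.∣ d →
                     ProdI d I J ≐ TraceIdeal (+ (m ℕ.* n))
  ProdI≐TraceIdeal {I} {J} {m} {n} I-ideal (I⊆T , T⊆I) (J⊆T , T⊆J) m⊥n mn∣d =
    ideal≐TraceIdeal (ProdI-isIdeal I-ideal) mn∣Δ IJ⊆T mn∈IJ (proj₂ ω∈IJ)
    where
    open IsIdeal (ProdI-isIdeal {J = J} I-ideal)
    mn∣Δ = ∣d⇒∣Δ mn∣d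
    m∣Δ = ∣-trans (∣m⇒∣m*n (+ n) ∣-refl) (subst (_∣ Δ) (ℤ.pos-* m n) mn∣Δ)
    n∣Δ = ∣-trans (∣n⇒∣m*n (+ m) ∣-refl) (subst (_∣ Δ) (ℤ.pos-* m n) mn∣Δ)

    IJ⊆T : ProdI d I J ⊆ TraceIdeal (+ (m ℕ.* n))
    IJ⊆T (gen {a} {b} a∈I b∈J) = ∣Δ∧∣2*⇒∣ mn∣Δ (subst (_ ∣_) (sym (2tr-· a b))
      (∣m∣n⇒∣m+n (subst (_∣ tr a * tr b) (sym (ℤ.pos-* m n)) (*-pres-∣ (I⊆T a∈I) (J⊆T b∈J)))
                 (∣m⇒∣m*n (y a * y b) mn∣Δ)))
    IJ⊆T zero = divides 0 refl
    IJ⊆T (add {a} {b} a∈IJ b∈IJ) = TraceIdeal-⊕ {α = a} {β = b} (IJ⊆T a∈IJ) (IJ⊆T b∈IJ)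

    m∈I : I (fromℤK (+ m))
    m∈I = T⊆I (m∈TraceIdeal (+ m))
    n∈J : J (fromℤK (+ n))
    n∈J = T⊆J (m∈TraceIdeal (+ n))

    mn∈IJ : ProdI d I J (fromℤK (+ (m ℕ.* n)))
    mn∈IJ = subst (ProdI d I J)
      (trans (fromℤK-· (+ m) (fromℤK (+ n))) (OK-≡ (sym (ℤ.pos-* m n)) (ℤ.*-zeroʳ (+ m))))
      (gen m∈I n∈J)

    jₘ = proj₁ (∣Δ⇒odd m∣Δ)
    jₙ = proj₁ (∣Δ⇒odd n∣Δ)
    ωₘ∈I : I ⟨ jₘ , 1 ⟩
    ωₘ∈I = T⊆I (∣-reflexive (proj₂ (∣Δ⇒odd m∣Δ)))
    ωₙ∈J : J ⟨ jₙ , 1 ⟩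
    ωₙ∈J = T⊆J (∣-reflexive (proj₂ (∣Δ⇒odd n∣Δ)))

    -- u m ωₙ + v n ωₘ has y-coordinate u m + v n = 1
    ω∈IJ : ∃[ w ] ProdI d I J ⟨ w , 1 ⟩
    ω∈IJ = combine (coprime⇒bézout m⊥n)
      where
      combine : ∃[ u ] ∃[ v ] u * + m + v * + n ≡ 1 → ∃[ w ] ProdI d I J ⟨ w , 1 ⟩
      combine (u , v , um+vn≡1) = _ , subst (ProdI d I J) combination≡
        (add∈ _ _ (mul∈ (fromℤK u) _ (gen m∈I ωₙ∈J))
                  (mul∈ (fromℤK v) _ (subst (ProdI d I J) (·-comm ⟨ jₘ , 1 ⟩ (fromℤK (+ n))) (gen ωₘ∈I n∈J))))
        where
        y-eq : u * (+ m * 1) + v * (+ n * 1) ≡ 1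
        y-eq = trans (cong₂ (λ s t → u * s + v * t) (ℤ.*-identityʳ (+ m)) (ℤ.*-identityʳ (+ n))) um+vn≡1
        combination≡ : fromℤK u · (fromℤK (+ m) · ⟨ jₙ , 1 ⟩) ⊕ fromℤK v · (fromℤK (+ n) · ⟨ jₘ , 1 ⟩)
                     ≡ ⟨ u * (+ m * jₙ) + v * (+ n * jₘ) , 1 ⟩
        combination≡ = begin
          fromℤK u · (fromℤK (+ m) · ⟨ jₙ , 1 ⟩) ⊕ fromℤK v · (fromℤK (+ n) · ⟨ jₘ , 1 ⟩)
            ≡⟨ cong₂ (λ s t → fromℤK u · s ⊕ fromℤK v · t) (fromℤK-· (+ m) _) (fromℤK-· (+ n) _) ⟩
          fromℤK u · ⟨ + m * jₙ , + m * 1 ⟩ ⊕ fromℤK v · ⟨ + n * jₘ , + n * 1 ⟩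
            ≡⟨ cong₂ _⊕_ (fromℤK-· u _) (fromℤK-· v _) ⟩
          ⟨ u * (+ m * jₙ) + v * (+ n * jₘ) , u * (+ m * 1) + v * (+ n * 1) ⟩
            ≡⟨ OK-≡ refl y-eq ⟩
          ⟨ u * (+ m * jₙ) + v * (+ n * jₘ) , 1 ⟩ ∎

  ProdList≐TraceIdeal : SquareFree d → (P : ℕ → OK → Set) →
    (∀ p → Prime p → p ℕ.∣ d → IsPrimeIdeal d (P p) × P p (fromℕK p)) →
    ∀ {ps} → All Prime ps → product ps ℕ.∣ d → ProdList d (map P ps) ≐ TraceIdeal (+ product ps)
  ProdList≐TraceIdeal sf P P-prime {[]} All.[] _ =
    (λ {α} _ → divides (tr α) (sym (ℤ.*-identityʳ (tr α)))) , λ _ → tt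
  ProdList≐TraceIdeal sf P P-prime {p ∷ ps} (p-prime All.∷ ps-prime) p∏∣d =
    ProdI≐TraceIdeal Pp-ideal
                     (primeIdeal≐TraceIdeal p-prime p∣d Pp-prime p∈Pp)
                     Ps≐T (squarefree⇒coprime sf p∏∣d) p∏∣d
    where
    p∣d = ℕ.∣-trans (ℕ.m∣m*n (product ps)) p∏∣d
    ∏∣d = ℕ.∣-trans (ℕ.n∣m*n p) p∏∣d
    Pp-prime = proj₁ (P-prime p p-prime p∣d)
    Pp-ideal = proj₁ Pp-prime
    p∈Pp = proj₂ (P-prime p p-prime p∣d)
    Ps≐T = ProdList≐TraceIdeal sf P P-prime ps-prime ∏∣d

  module _ {m n : ℕ} (mn≡d : m ℕ.* n ≡ d) where

    Δ≡mn : Δ ≡ + m * + n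
    Δ≡mn = trans (sym d≡Δ) (trans (cong +_ (sym mn≡d)) (ℤ.pos-* m n))

    m∣Δ : + m ∣ Δ
    m∣Δ = subst (_ ∣_) (sym Δ≡mn) (∣m⇒∣m*n (+ n) ∣-refl)

    n∣Δ : + n ∣ Δ
    n∣Δ = subst (_ ∣_) (sym Δ≡mn) (∣n⇒∣m*n (+ m) ∣-refl)

    m≢0 : + m ≢ 0
    m≢0 with ∣Δ⇒odd m∣Δ
    ... | j , m≡2j+1 = λ m≡0 → odd≢0 j (trans (sym m≡2j+1) m≡0)

    4norm≡m[ma²-ny²] : ∀ {g a} → tr g ≡ a * + m → 4 * norm g ≡ + m * (a * a * + m - y g * y g * + n)
    4norm≡m[ma²-ny²] {g} {a} tr≡am = begin
      4 * norm g                                    ≡⟨ 4norm≡tr²-Δy² g ⟩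
      tr g * tr g - Δ * (y g * y g)                 ≡⟨ cong₂ (λ t D → t * t - D * (y g * y g)) tr≡am Δ≡mn ⟩
      a * + m * (a * + m) - + m * + n * (y g * y g) ≡⟨ factor a (y g) (+ m) (+ n) ⟩
      + m * (a * a * + m - y g * y g * + n)         ∎
      where
      factor : ∀ a b m n → a * m * (a * m) - m * n * (b * b) ≡ m * (a * a * m - b * b * n)
      factor = solve-∀

    -- with N(g) = f m, the norms of m and √d show f ∣ m and f ∣ n
    principal⇒Pell : SquareFree d → Principal d (TraceIdeal (+ m)) → Pell (+ m) (+ n)
    principal⇒Pell sf (g , T≡⟨g⟩) = a , y g , ±4
      where
      instance _ = ℤ.≢-nonZero m≢0
      generated : ∀ {α} → TraceIdeal (+ m) α → g ∣ᴼ α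
      generated {α} = Equivalence.to (T≡⟨g⟩ α)
      g∈T : TraceIdeal (+ m) g
      g∈T = Equivalence.from (T≡⟨g⟩ g) (oneK , sym (·-identityˡ g))
      a = quotient g∈T
      e = a * a * + m - y g * y g * + n
      4Ng≡me : 4 * norm g ≡ + m * e
      4Ng≡me = 4norm≡m[ma²-ny²] {g} {a} (_∣_.equality g∈T)
      m∣Ng : + m ∣ norm g
      m∣Ng = ∣Δ∧∣2*⇒∣ m∣Δ (∣Δ∧∣2*⇒∣ m∣Δ
               (subst (_ ∣_) (trans (sym 4Ng≡me) (ℤ.*-assoc 2 2 (norm g))) (∣m⇒∣m*n e ∣-refl)))
      f = quotient m∣Ng
      e≡4f : e ≡ 4 * f
      e≡4f = ℤ.*-cancelˡ-≡ (+ m) e (4 * f) (begin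
        + m * e          ≡⟨ sym 4Ng≡me ⟩
        4 * norm g       ≡⟨ cong (λ t → 4 * t) (_∣_.equality m∣Ng) ⟩
        4 * (f * + m)    ≡⟨ rearrange f (+ m) ⟩
        + m * (4 * f)    ∎)
        where
        rearrange : ∀ f m → 4 * (f * m) ≡ m * (4 * f)
        rearrange = solve-∀
      f∣m : f ∣ + m
      f∣m = *-cancelʳ-∣ (+ m) (subst₂ _∣_ (_∣_.equality m∣Ng) (norm-fromℤK (+ m))
              (∣ᴼ⇒norm∣ {g} (generated {fromℤK (+ m)} (m∈TraceIdeal (+ m)))))
      f∣n : f ∣ + n
      f∣n = *-cancelʳ-∣ (+ m) (subst₂ _∣_ (_∣_.equality m∣Ng) -N√d≡nm
              (∣m⇒∣-m (∣ᴼ⇒norm∣ {g} (generated {√d} (divides 0 refl)))))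
        where
        -N√d≡nm : - norm √d ≡ + n * + m
        -N√d≡nm = trans (cong -_ norm-√d) (trans (ℤ.neg-involutive Δ) (trans Δ≡mn (ℤ.*-comm (+ m) (+ n))))
      ±4 : (e ≡ 4) ⊎ (e ≡ -4)
      ±4 = Sum.map (λ f≡1 → trans e≡4f (cong (λ t → 4 * t) f≡1))
                   (λ f≡-1 → trans e≡4f (cong (λ t → 4 * t) f≡-1))
                   (squarefree-unit sf mn≡d f∣m f∣n)

    -- divide by g via α ḡ ∈ m O_K = N(g) O_K
    unit-norm-generates : ∀ {g σ} → TraceIdeal (+ m) g → σ * σ ≡ 1 → norm g ≡ σ * + m →
                          ∀ α → TraceIdeal (+ m) α ⇔ g ∣ᴼ α
    unit-norm-generates {g} {σ} g∈T σ²≡1 Ng≡σm α = mk⇔ T⇒∣ᴼ ∣ᴼ⇒T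
      where
      Ng≢0 : norm g ≢ 0
      Ng≢0 Ng≡0 with ℤ.i*j≡0⇒i≡0∨j≡0 σ (trans (sym Ng≡σm) Ng≡0)
      ... | inj₁ σ≡0 = 1≢0 (trans (sym σ²≡1) (cong (λ s → s * s) σ≡0))
        where
        1≢0 : 1 ≢ 0
        1≢0 ()
      ... | inj₂ m≡0 = m≢0 m≡0
      unit : ∀ t → + m * t ≡ σ * + m * (σ * t)
      unit t = begin
        + m * t               ≡⟨ sym (ℤ.*-identityˡ (+ m * t)) ⟩
        1 * (+ m * t)         ≡⟨ cong (λ s → s * (+ m * t)) (sym σ²≡1) ⟩
        σ * σ * (+ m * t)     ≡⟨ rearrange σ (+ m) t ⟩
        σ * + m * (σ * t)     ∎
        where
        rearrange : ∀ s M t → s * s * (M * t) ≡ s * M * (s * t)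
        rearrange = solve-∀
      m·ρ≡Ng·σρ : ∀ ρ → fromℤK (+ m) · ρ ≡ fromℤK (norm g) · (fromℤK σ · ρ)
      m·ρ≡Ng·σρ ρ = begin
        fromℤK (+ m) · ρ
          ≡⟨ fromℤK-· (+ m) ρ ⟩
        ⟨ + m * x ρ , + m * y ρ ⟩
          ≡⟨ OK-≡ (unit (x ρ)) (unit (y ρ)) ⟩
        ⟨ σ * + m * (σ * x ρ) , σ * + m * (σ * y ρ) ⟩
          ≡⟨ sym (fromℤK-· (σ * + m) ⟨ σ * x ρ , σ * y ρ ⟩) ⟩
        fromℤK (σ * + m) · ⟨ σ * x ρ , σ * y ρ ⟩
          ≡⟨ cong₂ (λ N β → fromℤK N · β) (sym Ng≡σm) (sym (fromℤK-· σ ρ)) ⟩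
        fromℤK (norm g) · (fromℤK σ · ρ) ∎
      T⇒∣ᴼ : TraceIdeal (+ m) α → g ∣ᴼ α
      T⇒∣ᴼ α∈T = fromℤK σ · ρ , ∣ᴼ-by-conj {g} {α} Ng≢0 (trans αḡ≡mρ (m·ρ≡Ng·σρ ρ))
        where
        ρ = proj₁ (TraceIdeal-·-conj m∣Δ {α} {g} α∈T g∈T)
        αḡ≡mρ = proj₂ (TraceIdeal-·-conj m∣Δ {α} {g} α∈T g∈T)
      ∣ᴼ⇒T : g ∣ᴼ α → TraceIdeal (+ m) α
      ∣ᴼ⇒T (r , α≡rg) = subst (TraceIdeal (+ m)) (sym α≡rg) (TraceIdeal-· m∣Δ r {g} g∈T)

    -- the generator is g = (m a + b √d)/2, an element of O_K because a ≡ b (mod 2)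
    Pell⇒principal : Pell (+ m) (+ n) → Principal d (TraceIdeal (+ m))
    Pell⇒principal (a , b , ±4) = generator (unit ±4) (∣Δ⇒odd m∣Δ) (∣Δ⇒odd n∣Δ)
      where
      F = a * a * + m - b * b * + n
      unit : (F ≡ 4) ⊎ (F ≡ -4) → ∃[ σ ] σ * σ ≡ 1 × F ≡ 4 * σ
      unit (inj₁ F≡4)  = 1 , refl , F≡4
      unit (inj₂ F≡-4) = -1 , refl , F≡-4
      generator : ∃[ σ ] σ * σ ≡ 1 × F ≡ 4 * σ → ∃[ j ] + m ≡ 2 * j + 1 → ∃[ k ] + n ≡ 2 * k + 1 →
                  Principal d (TraceIdeal (+ m))
      generator (σ , σ²≡1 , F≡4σ) (j , m≡2j+1) (k , n≡2k+1) = from-parity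
        (odd-form-parity j k a b (2 * σ)
          (subst₂ (λ M N → a * a * M - b * b * N ≡ 2 * (2 * σ)) m≡2j+1 n≡2k+1 (trans F≡4σ (ℤ.*-assoc 2 2 σ))))
        where
        from-parity : ∃[ h ] a ≡ b + 2 * h → Principal d (TraceIdeal (+ m))
        from-parity (h , a≡b+2h) = g , unit-norm-generates {g} {σ} (divides a tr≡am) σ²≡1 Ng≡σm
          where
          g = ⟨ j * a + h , b ⟩
          tr≡am : tr g ≡ a * + m
          tr≡am = begin
            2 * (j * a + h) + b      ≡⟨ solve (j ∷ a ∷ h ∷ b ∷ []) ⟩
            2 * (j * a) + (b + 2 * h) ≡⟨ cong (λ t → 2 * (j * a) + t) (sym a≡b+2h) ⟩
            2 * (j * a) + a          ≡⟨ solve (j ∷ a ∷ []) ⟩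
            a * (2 * j + 1)          ≡⟨ cong (λ t → a * t) (sym m≡2j+1) ⟩
            a * + m                  ∎
          Ng≡σm : norm g ≡ σ * + m
          Ng≡σm = ℤ.*-cancelˡ-≡ 4 (norm g) (σ * + m) (begin
            4 * norm g       ≡⟨ 4norm≡m[ma²-ny²] {g} {a} tr≡am ⟩
            + m * F          ≡⟨ cong (λ t → + m * t) F≡4σ ⟩
            + m * (4 * σ)    ≡⟨ rearrange (+ m) σ ⟩
            4 * (σ * + m)    ∎)
            where
            rearrange : ∀ m σ → m * (4 * σ) ≡ 4 * (σ * m)
            rearrange = solve-∀

    normQ≡m·form : ∀ {α a} → tr α ≡ a * + m → normQ d α ≡ + (m ℕ.* form m n ∣ a ∣ ∣ y α ∣)
    normQ≡m·form {α} {a} tr≡am = begin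
      normQ d α
        ≡⟨ cong₂ (λ t D → t * t + D * (y α * y α)) tr≡am (trans (cong +_ (sym mn≡d)) (ℤ.pos-* m n)) ⟩
      a * + m * (a * + m) + + m * + n * (y α * y α)
        ≡⟨ factor a (y α) (+ m) (+ n) ⟩
      + m * (+ m * (a * a) + + n * (y α * y α))
        ≡⟨ cong₂ (λ s t → + m * (+ m * s + + n * t)) (square≡∣∣² a) (square≡∣∣² (y α)) ⟩
      + m * (+ m * + (∣ a ∣ ℕ.* ∣ a ∣) + + n * + (∣ y α ∣ ℕ.* ∣ y α ∣))
        ≡⟨ cong₂ (λ s t → + m * (s + t)) (sym (ℤ.pos-* m _)) (sym (ℤ.pos-* n _)) ⟩
      + m * + form m n ∣ a ∣ ∣ y α ∣
        ≡⟨ sym (ℤ.pos-* m _) ⟩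
      + (m ℕ.* form m n ∣ a ∣ ∣ y α ∣) ∎
      where
      factor : ∀ a b m n → a * m * (a * m) + m * n * (b * b) ≡ m * (m * (a * a) + n * (b * b))
      factor = solve-∀

    TraceIdeal-parity : ∀ {α a} → tr α ≡ a * + m → ∃[ h ] a ≡ y α + 2 * h
    TraceIdeal-parity {α} {a} tr≡am = from-odd (∣Δ⇒odd m∣Δ)
      where
      from-odd : ∃[ j ] + m ≡ 2 * j + 1 → ∃[ h ] a ≡ y α + 2 * h
      from-odd (j , m≡2j+1) = x α - j * a , (begin
        a                            ≡⟨ e₁ a j ⟩
        a * (2 * j + 1) - 2 * (j * a) ≡⟨ cong (λ t → a * t - 2 * (j * a)) (sym m≡2j+1) ⟩
        a * + m - 2 * (j * a)         ≡⟨ cong (λ t → t - 2 * (j * a)) (sym tr≡am) ⟩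
        2 * x α + y α - 2 * (j * a)   ≡⟨ e₂ (x α) (y α) j a ⟩
        y α + 2 * (x α - j * a)       ∎)
        where
        e₁ : ∀ a j → a ≡ a * (2 * j + 1) - 2 * (j * a)
        e₁ = solve-∀
        e₂ : ∀ x y j a → 2 * x + y - 2 * (j * a) ≡ y + 2 * (x - j * a)
        e₂ = solve-∀

    TraceIdeal-shape : ∀ {α a} → tr α ≡ a * + m → α ≢ zeroK →
                       (∣ y α ∣ ≡ 0 → 2 ℕ.≤ ∣ a ∣) × (∣ a ∣ ≡ 0 → 2 ℕ.≤ ∣ y α ∣)
    TraceIdeal-shape {α} {a} tr≡am α≢0 = shape (TraceIdeal-parity {α} {a} tr≡am)
      where
      not-both-0 : a ≡ 0 → y α ≢ 0
      not-both-0 a≡0 y≡0 = α≢0 (tr-injective {α} {zeroK} (trans tr≡am (cong (λ t → t * + m) a≡0)) y≡0)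
      shape : ∃[ h ] a ≡ y α + 2 * h → (∣ y α ∣ ≡ 0 → 2 ℕ.≤ ∣ a ∣) × (∣ a ∣ ≡ 0 → 2 ℕ.≤ ∣ y α ∣)
      shape (h , a≡y+2h) = a-even , y-even
        where
        a-even : ∣ y α ∣ ≡ 0 → 2 ℕ.≤ ∣ a ∣
        a-even ∣y∣≡0 = even≢0⇒2≤∣∣ h a≡2h (λ a≡0 → not-both-0 a≡0 y≡0)
          where
          y≡0 = ℤ.∣i∣≡0⇒i≡0 ∣y∣≡0
          a≡2h = trans a≡y+2h (trans (cong (λ t → t + 2 * h) y≡0) (ℤ.+-identityˡ (2 * h)))
        y-even : ∣ a ∣ ≡ 0 → 2 ℕ.≤ ∣ y α ∣
        y-even ∣a∣≡0 = even≢0⇒2≤∣∣ (- h) y≡-2h (not-both-0 a≡0)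
          where
          a≡0 = ℤ.∣i∣≡0⇒i≡0 ∣a∣≡0
          e : ∀ y h → y ≡ y + 2 * h + 2 * - h
          e = solve-∀
          y≡-2h = begin
            y α                      ≡⟨ e (y α) h ⟩
            y α + 2 * h + 2 * - h    ≡⟨ cong (λ t → t + 2 * - h) (trans (sym a≡y+2h) a≡0) ⟩
            0 + 2 * - h              ≡⟨ ℤ.+-identityˡ (2 * - h) ⟩
            2 * - h                  ∎

    TraceIdeal-norm-bound : n ℕ.≤ 3 ℕ.* m → m ℕ.≤ 3 ℕ.* n → ∀ {γ} → TraceIdeal (+ m) γ → γ ≢ zeroK →
                            + (m ℕ.* form m n 1 1) ℤ.≤ normQ d γ
    TraceIdeal-norm-bound n≤3m m≤3n {γ} (divides a tr≡am) γ≢0 =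
      subst (_ ℤ.≤_) (sym (normQ≡m·form {γ} {a} tr≡am))
        (ℤ.+≤+ (ℕ.*-monoʳ-≤ m (form-lower {m} {n} n≤3m m≤3n (proj₁ shape) (proj₂ shape))))
      where
      shape = TraceIdeal-shape {γ} {a} tr≡am γ≢0

    TraceIdeal-halfBasis : n ℕ.≤ 3 ℕ.* m → m ℕ.≤ 3 ℕ.* n → HalfBasisClaim d m (TraceIdeal (+ m))
    TraceIdeal-halfBasis n≤3m m≤3n α β trα≡m yα≡1 trβ≡m yβ≡-1 =
      minimal trα≡m (cong ∣_∣ yα≡1) , minimal trβ≡m (cong ∣_∣ yβ≡-1) , indep , spans
      where
      minimal : ∀ {α} → tr α ≡ + m → ∣ y α ∣ ≡ 1 → Minimal d (TraceIdeal (+ m)) α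
      minimal {α} trα≡m ∣y∣≡1 = divides 1 tr≡1·m , α≢0 ,
        λ γ γ∈T γ≢0 → subst (ℤ._≤ normQ d γ) (sym normα) (TraceIdeal-norm-bound n≤3m m≤3n {γ} γ∈T γ≢0)
        where
        tr≡1·m : tr α ≡ 1 * + m
        tr≡1·m = trans trα≡m (sym (ℤ.*-identityˡ (+ m)))
        α≢0 : α ≢ zeroK
        α≢0 α≡0 with trans (sym ∣y∣≡1) (cong (λ γ → ∣ y γ ∣) α≡0)
        ... | ()
        normα : normQ d α ≡ + (m ℕ.* form m n 1 1)
        normα = trans (normQ≡m·form {α} {1} tr≡1·m) (cong (λ B → + (m ℕ.* form m n 1 B)) ∣y∣≡1)

      indep : Indep α β
      indep det≡0 = [ (λ ()) , m≢0 ]′ (ℤ.i*j≡0⇒i≡0∨j≡0 2 (begin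
        2 * + m                                       ≡⟨ negate (+ m) ⟩
        - (+ m * -1 - + m * 1)
          ≡⟨ cong₂ (λ s t → - (s * -1 - t * 1)) (sym trα≡m) (sym trβ≡m) ⟩
        - (coordA α * -1 - coordA β * 1)
          ≡⟨ cong₂ (λ s t → - (coordA α * s - coordA β * t)) (sym yβ≡-1) (sym yα≡1) ⟩
        - (coordA α * coordB β - coordA β * coordB α) ≡⟨ cong -_ det≡0 ⟩
        0                                             ∎))
        where
        negate : ∀ m → 2 * m ≡ - (m * -1 - m * 1)
        negate = solve-∀

      spans : ∀ γ → TraceIdeal (+ m) γ → ∃[ k ] ∃[ l ] γ ≡ fromℤK k · α ⊕ fromℤK l · β
      spans γ (divides a tr≡am) = span (TraceIdeal-parity {γ} {a} tr≡am)
        where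
        span : ∃[ h ] a ≡ y γ + 2 * h → ∃[ k ] ∃[ l ] γ ≡ fromℤK k · α ⊕ fromℤK l · β
        span (h , a≡y+2h) = y γ + h , h , sym (tr-injective tr-eq y-eq)
          where
          collect : ∀ y h m → (y + h) * m + h * m ≡ (y + 2 * h) * m
          collect = solve-∀
          cancel : ∀ y h → (y + h) * 1 + h * -1 ≡ y
          cancel = solve-∀
          tr-eq : tr (fromℤK (y γ + h) · α ⊕ fromℤK h · β) ≡ tr γ
          tr-eq = begin
            tr (fromℤK (y γ + h) · α ⊕ fromℤK h · β)
              ≡⟨ tr-⊕ (fromℤK (y γ + h) · α) (fromℤK h · β) ⟩
            tr (fromℤK (y γ + h) · α) + tr (fromℤK h · β)
              ≡⟨ cong₂ _+_ (tr-fromℤK-· (y γ + h) α) (tr-fromℤK-· h β) ⟩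
            (y γ + h) * tr α + h * tr β
              ≡⟨ cong₂ (λ s t → (y γ + h) * s + h * t) trα≡m trβ≡m ⟩
            (y γ + h) * + m + h * + m
              ≡⟨ collect (y γ) h (+ m) ⟩
            (y γ + 2 * h) * + m
              ≡⟨ cong (λ t → t * + m) (sym a≡y+2h) ⟩
            a * + m
              ≡⟨ sym tr≡am ⟩
            tr γ ∎
          y-eq : y (fromℤK (y γ + h) · α ⊕ fromℤK h · β) ≡ y γ
          y-eq = begin
            y (fromℤK (y γ + h) · α) + y (fromℤK h · β)
              ≡⟨ cong₂ (λ s t → y s + y t) (fromℤK-· (y γ + h) α) (fromℤK-· h β) ⟩
            (y γ + h) * y α + h * y β
              ≡⟨ cong₂ (λ s t → (y γ + h) * s + h * t) yα≡1 yβ≡-1 ⟩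
            (y γ + h) * 1 + h * -1
              ≡⟨ cancel (y γ) h ⟩
            y γ ∎

    TraceIdeal-WR : n ℕ.≤ 3 ℕ.* m → m ℕ.≤ 3 ℕ.* n → WR d (TraceIdeal (+ m))
    TraceIdeal-WR n≤3m m≤3n = from-odd (∣Δ⇒odd m∣Δ)
      where
      from-odd : ∃[ j ] + m ≡ 2 * j + 1 → WR d (TraceIdeal (+ m))
      from-odd (j , m≡2j+1) =
        ⟨ j , 1 ⟩ , ⟨ j + 1 , -1 ⟩ , proj₁ basis , proj₁ (proj₂ basis) , proj₁ (proj₂ (proj₂ basis))
        where
        shift : ∀ j → 2 * (j + 1) + -1 ≡ 2 * j + 1
        shift = solve-∀
        basis = TraceIdeal-halfBasis n≤3m m≤3n ⟨ j , 1 ⟩ ⟨ j + 1 , -1 ⟩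
                  (sym m≡2j+1) refl (trans (shift j) (sym m≡2j+1)) refl

    TraceIdeal-PWR : n ℕ.≤ 3 ℕ.* m → m ℕ.≤ 3 ℕ.* n → Pell (+ m) (+ n) → PWR d (TraceIdeal (+ m))
    TraceIdeal-PWR n≤3m m≤3n pell = Pell⇒principal pell , TraceIdeal-WR n≤3m m≤3n

    -- beyond 3m < n every shortest vector is a rational integer
    TraceIdeal-¬WR : 3 ℕ.* m ℕ.< n → ¬ WR d (TraceIdeal (+ m))
    TraceIdeal-¬WR 3m<n (α , β , α-min , β-min , indep) = indep (begin
      coordA α * coordB β - coordA β * coordB α
        ≡⟨ cong₂ (λ s t → coordA α * s - coordA β * t) (y≡0 β-min) (y≡0 α-min) ⟩
      coordA α * 0 - coordA β * 0
        ≡⟨ vanish (coordA α) (coordA β) ⟩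
      0 ∎)
      where
      vanish : ∀ a b → a * 0 - b * 0 ≡ 0
      vanish = solve-∀
      instance _ = ℕ.≢-nonZero (λ m≡0 → m≢0 (cong +_ m≡0))
      m∈T = m∈TraceIdeal (+ m)
      normm : normQ d (fromℤK (+ m)) ≡ + (m ℕ.* form m n 2 0)
      normm = normQ≡m·form {fromℤK (+ m)} {2} (_∣_.equality m∈T)
      y≡0 : ∀ {γ} → Minimal d (TraceIdeal (+ m)) γ → y γ ≡ 0
      y≡0 {γ} (divides a tr≡am , γ≢0 , γ-shortest) = decidable-stable (y γ ℤ.≟ 0) λ y≢0 →
        ℕ.<⇒≱ (ℕ.*-monoʳ-< m (form-strict {m} {n} 3m<n (ℕ.n≢0⇒n>0 (y≢0 ∘ ℤ.∣i∣≡0⇒i≡0)) (proj₂ shape)))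
              (ℤ.drop‿+≤+ (subst₂ ℤ._≤_ (normQ≡m·form {γ} {a} tr≡am) normm
                              (γ-shortest (fromℤK (+ m)) m∈T (m≢0 ∘ cong x))))
        where
        shape = TraceIdeal-shape {γ} {a} tr≡am γ≢0


open import Data.Nat using (ℕ; _<_; _*_; _%_)
open import Data.Nat.Divisibility using (_∣_)
open import Data.Nat.Primality using (Prime)
open import Data.Integer as ℤ using (ℤ; +_; -_)
open import Data.List using (List; map)
open import Data.Nat.ListAction using (product)
open import Data.List.Relation.Unary.All using (All)
open import Data.Product using (_×_; ∃-syntax)
open import Data.Sum using (_⊎_)
open import Relation.Binary.PropositionalEquality using (_≡_)
open import Function.Bundles using (_⇔_)
open IntegerFacts using (Pell; Pell-swap; %4≡1⇒≡4c+1; n≢3*m)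

proposition3p5 :
    (d : ℕ) → 1 < d → SquareFree d → d % 4 ≡ 1 →
    (d₁ d₂ : ℕ) → 0 < d₁ → d₁ * d₂ ≡ d → d₁ < d₂ →
    (ps qs : List ℕ) → All Prime ps → product ps ≡ d₁ → All Prime qs → product qs ≡ d₂ →
    (P : ℕ → OK → Set) →
    (∀ p → Prime p → p ∣ d → IsPrimeIdeal d (P p) × P p (fromℕK p)) →
    let I₁ = ProdList d (map P ps)
        I₂ = ProdList d (map P qs)
    in ((PWR d I₁ × PWR d I₂) ⇔
         (d₂ < 3 * d₁ ×
          (∃[ k ] ∃[ ℓ ] ((k ℤ.* k ℤ.* + d₂ ℤ.- ℓ ℤ.* ℓ ℤ.* + d₁ ≡ + 4)
                        ⊎ (k ℤ.* k ℤ.* + d₂ ℤ.- ℓ ℤ.* ℓ ℤ.* + d₁ ≡ - (+ 4))))))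
       × ((PWR d I₁ × PWR d I₂) →
          HalfBasisClaim d d₁ I₁ × HalfBasisClaim d d₂ I₂)
proposition3p5 d _ sf d%4≡1 d₁ d₂ _ d₁d₂≡d d₁<d₂ ps qs ps-prime ∏ps≡d₁ qs-prime ∏qs≡d₂ P P-prime =
  mk⇔ PWR⇒conditions conditions⇒PWR , PWR⇒halfBases
  where
  open TraceIdeals d (%4≡1⇒≡4c+1 d%4≡1)
  d₂d₁≡d = trans (ℕ.*-comm d₂ d₁) d₁d₂≡d
  d₁≤3d₂ = ℕ.≤-trans (ℕ.<⇒≤ d₁<d₂) (ℕ.m≤m+n d₂ (2 * d₂))

  primes≐T : ∀ {qs m n} → All Prime qs → product qs ≡ m → n * m ≡ d → ProdList d (map P qs) ≐ TraceIdeal (+ m)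
  primes≐T {n = n} qs-prime refl nm≡d = ProdList≐TraceIdeal sf P P-prime qs-prime (ℕ.divides n (sym nm≡d))
  I₁≐T = primes≐T {n = d₂} ps-prime ∏ps≡d₁ d₂d₁≡d
  I₂≐T = primes≐T {n = d₁} qs-prime ∏qs≡d₂ d₁d₂≡d

  d₂<3d₁ : WR d (ProdList d (map P ps)) → d₂ < 3 * d₁
  d₂<3d₁ wr = ℕ.≤∧≢⇒< (ℕ.≮⇒≥ (λ 3d₁<d₂ → TraceIdeal-¬WR d₁d₂≡d 3d₁<d₂ (WR-resp-≐ {d} I₁≐T wr)))
                      (n≢3*m {m = d₁} sf d%4≡1 d₁d₂≡d)

  PWR⇒conditions = λ ((_ , wr₁) , (principal₂ , _)) →
    d₂<3d₁ wr₁ , principal⇒Pell d₂d₁≡d sf (Principal-resp-≐ {d} I₂≐T principal₂)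

  conditions⇒PWR = λ (d₂<3d₁ , pell) →
    PWR-resp-≐ {d} (≐-sym I₁≐T) (TraceIdeal-PWR d₁d₂≡d (ℕ.<⇒≤ d₂<3d₁) d₁≤3d₂ (Pell-swap pell)) ,
    PWR-resp-≐ {d} (≐-sym I₂≐T) (TraceIdeal-PWR d₂d₁≡d d₁≤3d₂ (ℕ.<⇒≤ d₂<3d₁) pell)

  PWR⇒halfBases = λ ((_ , wr₁) , _) →
    HalfBasisClaim-resp-≐ {d} (≐-sym I₁≐T) (TraceIdeal-halfBasis d₁d₂≡d (ℕ.<⇒≤ (d₂<3d₁ wr₁)) d₁≤3d₂) ,
    HalfBasisClaim-resp-≐ {d} (≐-sym I₂≐T) (TraceIdeal-halfBasis d₂d₁≡d d₁≤3d₂ (ℕ.<⇒≤ (d₂<3d₁ wr₁)))
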